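{- For integers $0\le a\le b$, define the $\zeta$-decomposition $\zeta(a,b)$, a finite sequence of buckets (integer index intervals), by $\zeta(b,b)=\langle B(b,b+1)\rangle$ and, for $a<b$, $\zeta(a,b)=\langle B(a,c),\zeta(c,b)\rangle$ where $c=a+2^{\lfloor\log_2(b+1-a)\rfloor-1}$. Define the operator $\mathrm{Incr}$ on $\zeta(a,b)$ by $\mathrm{Incr}(\zeta(b,b))=\langle B(b,b+1),B(b+1,b+2)\rangle$ and, for $a<b$, $\mathrm{Incr}(\zeta(a,b))=\langle B(a,v),\mathrm{Incr}(\zeta(v,b))\rangle$, where: if $\lfloor\log_2(b+2-a)\rfloor=\lfloor\log_2(b+1-a)\rfloor$ then $v=c$ with $B(a,c)$ the first bucket of $\zeta(a,b)$; otherwise $v=d$ with $B(c,d)$ the second bucket of $\zeta(a,b)$ (so $B(a,d)$ is the union of the first two buckets of $\zeta(a,b)$). Then for all $0\le a\le b$, $\mathrm{Incr}(\zeta(a,b))=\zeta(a,b+1)$.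
   Context: For integers $0\le x<y$, the bucket $B(x,y)$ denotes the set of stream elements $\{p_i : x\le i\le y-1\}$, identified with the index interval $[x,y-1]$. In the paper each bucket is stored as a bucket structure carrying, besides its endpoints, the first element $p_x$, its timestamp and two independent uniform random samples of the bucket; when two consecutive buckets are united into $B(a,d)$ each sample of the union is taken from either part with probability $1/2$. The claim concerns the resulting sequence of buckets. -}

module Defs where

open import Data.Nat using (ℕ; zero; suc; _+_; _∸_; _^_; _<ᵇ_; _≡ᵇ_)
open import Data.Nat.Logarithm using (⌊log₂_⌋)
open import Data.Bool using (true; false)
open import Data.List using (List; []; _∷_)
open import Data.Product using (_×_; _,_)

-- A bucket B(x,y) is represented by its endpoints (x , y): the index interval [x, y-1].
Bucket : Set
Bucket = ℕ × ℕ

B : ℕ → ℕ → Bucket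
B x y = (x , y)

split : ℕ → ℕ → ℕ
split a b = a + 2 ^ (⌊log₂ (suc b ∸ a) ⌋ ∸ 1)

-- ζ(a,b), by recursion on fuel (b - a strictly decreases since c > a).
-- For a ≥ b the base clause ζ(b,b) = ⟨B(b,b+1)⟩ is used (only a = b is meaningful).
zetaF : ℕ → ℕ → ℕ → List Bucket
zetaF zero    a b = []
zetaF (suc f) a b with a <ᵇ b
... | false = B b (suc b) ∷ []
... | true  = B a (split a b) ∷ zetaF f (split a b) b

ζ : ℕ → ℕ → List Bucket
ζ a b = zetaF (suc (b ∸ a)) a b

firstEnd : List Bucket → ℕ
firstEnd ((x , y) ∷ _) = y
firstEnd []            = 0

secondEnd : List Bucket → ℕ
secondEnd (_ ∷ (x , y) ∷ _) = y
secondEnd _                 = 0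

incrF : ℕ → ℕ → ℕ → List Bucket
incrF zero    a b = []
incrF (suc f) a b with a <ᵇ b
... | false = B b (suc b) ∷ B (suc b) (suc (suc b)) ∷ []
... | true with ⌊log₂ (suc (suc b) ∸ a) ⌋ ≡ᵇ ⌊log₂ (suc b ∸ a) ⌋
...   | true  = B a (firstEnd (ζ a b)) ∷ incrF f (firstEnd (ζ a b)) b
...   | false = B a (secondEnd (ζ a b)) ∷ incrF f (secondEnd (ζ a b)) b

Incrζ : ℕ → ℕ → List Bucket
Incrζ a b = incrF (suc (b ∸ a)) a b

{-# OPTIONS --safe #-}
module Submission where

-- Let n = b + 1 − a and k = ⌊log₂ n⌋: the first bucket of ζ(a,b) has size h = 2^(k−1),
-- which depends on n only through k. If ⌊log₂ (n+1)⌋ = k, then ζ(a,b+1) starts with the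
-- same bucket. Otherwise n + 1 = 2^(k+1); the remaining n − h = 3h − 1 elements still have
-- logarithm k, so the second bucket of ζ(a,b) also has size h, and the union of the first
-- two buckets is the first bucket, of size 2^k, of ζ(a,b+1). Either way Incr's v is the
-- first split point of ζ(a,b+1), and induction on b − a finishes the proof.

open import Defs
open import Data.Nat using (ℕ; suc; _≤_)
open import Relation.Binary.PropositionalEquality using (_≡_)

open import Data.Nat using (zero; _+_; _*_; _∸_; _^_; _<_; _≮_; _<ᵇ_; _≡ᵇ_; ⌊_/2⌋; z≤n; s≤s; z<s; s<s; s≤s⁻¹; s<s⁻¹)
open import Data.Nat.Properties
open import Data.Nat.Logarithm using (⌊log₂_⌋; ⌊log₂⌋-mono-≤; ⌊log₂⌊n/2⌋⌋≡⌊log₂n⌋∸1; ⌊log₂[2^n]⌋≡n)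
open import Data.Nat.Tactic.RingSolver using (solve-∀)
open import Data.Bool using (true; false)
open import Data.List using ([]; _∷_)
open import Data.Sum using (inj₁; inj₂)
open import Relation.Nullary using (contradiction)
open import Relation.Nullary.Reflects using (Reflects; ofʸ; ofⁿ; fromEquivalence)
open import Relation.Binary.PropositionalEquality
  using (_≢_; refl; sym; trans; cong; subst; module ≡-Reasoning)

n<2*m⇒⌊n/2⌋<m : ∀ n {m} → n < 2 * m → ⌊ n /2⌋ < m
n<2*m⇒⌊n/2⌋<m 0             {suc m} _          = z<s
n<2*m⇒⌊n/2⌋<m 1             {suc m} _          = z<s
n<2*m⇒⌊n/2⌋<m (suc (suc n)) {suc m} (s≤s n<2m) =
  s<s (n<2*m⇒⌊n/2⌋<m n (s<s⁻¹ (subst (suc (suc n) ≤_) (+-suc m (m + 0)) n<2m)))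

n<2^[1+k]⇒⌊log₂n⌋≤k : ∀ k {n} → n < 2 ^ suc k → ⌊log₂ n ⌋ ≤ k
n<2^[1+k]⇒⌊log₂n⌋≤k zero    {0}           _                 = z≤n
n<2^[1+k]⇒⌊log₂n⌋≤k zero    {1}           _                 = z≤n
n<2^[1+k]⇒⌊log₂n⌋≤k zero    {suc (suc n)} (s≤s (s≤s ()))
n<2^[1+k]⇒⌊log₂n⌋≤k (suc k) {n}           n<2^[2+k]         = begin
  ⌊log₂ n ⌋                 ≤⟨ m≤n+m∸n ⌊log₂ n ⌋ 1 ⟩
  suc (⌊log₂ n ⌋ ∸ 1)       ≡⟨ cong suc (⌊log₂⌊n/2⌋⌋≡⌊log₂n⌋∸1 n) ⟨
  suc ⌊log₂ ⌊ n /2⌋ ⌋       ≤⟨ s≤s (n<2^[1+k]⇒⌊log₂n⌋≤k k (n<2*m⇒⌊n/2⌋<m n n<2^[2+k])) ⟩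
  suc k                     ∎
  where open ≤-Reasoning

2^k≤n⇒k≤⌊log₂n⌋ : ∀ k {n} → 2 ^ k ≤ n → k ≤ ⌊log₂ n ⌋
2^k≤n⇒k≤⌊log₂n⌋ k 2^k≤n = subst (_≤ _) (⌊log₂[2^n]⌋≡n k) (⌊log₂⌋-mono-≤ 2^k≤n)

⌊log₂⌋-unique : ∀ k {n} → 2 ^ k ≤ n → n < 2 ^ suc k → ⌊log₂ n ⌋ ≡ k
⌊log₂⌋-unique k lower upper =
  ≤-antisym (n<2^[1+k]⇒⌊log₂n⌋≤k k upper) (2^k≤n⇒k≤⌊log₂n⌋ k lower)

n<2^[1+⌊log₂n⌋] : ∀ n → n < 2 ^ suc ⌊log₂ n ⌋
n<2^[1+⌊log₂n⌋] n = ≰⇒> (λ le → 1+n≰n (2^k≤n⇒k≤⌊log₂n⌋ (suc ⌊log₂ n ⌋) le))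

2^⌊log₂n⌋≤n : ∀ {n} → 0 < n → 2 ^ ⌊log₂ n ⌋ ≤ n
2^⌊log₂n⌋≤n {n} 0<n = ≮⇒≥ (n≮2^ ⌊log₂ n ⌋ ≤-refl)
  where
  n≮2^ : ∀ k → k ≤ ⌊log₂ n ⌋ → n ≮ 2 ^ k
  n≮2^ zero    _     n<1         = <⇒≱ 0<n (s≤s⁻¹ n<1)
  n≮2^ (suc k) 1+k≤L n<2^[1+k] = 1+n≰n (≤-trans 1+k≤L (n<2^[1+k]⇒⌊log₂n⌋≤k k n<2^[1+k]))

⌊log₂⌋-jump : ∀ n → ⌊log₂ (suc n) ⌋ ≢ ⌊log₂ n ⌋ → suc n ≡ 2 ^ suc ⌊log₂ n ⌋
⌊log₂⌋-jump n jump = ≤-antisym (n<2^[1+⌊log₂n⌋] n) (≮⇒≥ λ 1+n<2^[1+k] →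
  jump (≤-antisym (n<2^[1+k]⇒⌊log₂n⌋≤k _ 1+n<2^[1+k]) (⌊log₂⌋-mono-≤ (n≤1+n n))))

-- The size of the first bucket of ζ on n elements; split a b = a + headSize (suc b ∸ a) definitionally.
headSize : ℕ → ℕ
headSize n = 2 ^ (⌊log₂ n ⌋ ∸ 1)

headSize-mono-≤ : ∀ {m n} → m ≤ n → headSize m ≤ headSize n
headSize-mono-≤ m≤n = ^-monoʳ-≤ 2 (∸-monoˡ-≤ 1 (⌊log₂⌋-mono-≤ m≤n))

2*headSize≡2^⌊log₂⌋ : ∀ {n} → 2 ≤ n → 2 * headSize n ≡ 2 ^ ⌊log₂ n ⌋
2*headSize≡2^⌊log₂⌋ 2≤n = cong (2 ^_) (m+[n∸m]≡n (⌊log₂⌋-mono-≤ 2≤n))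

2*headSize≤n : ∀ {n} → 2 ≤ n → 2 * headSize n ≤ n
2*headSize≤n {n} 2≤n =
  subst (_≤ n) (sym (2*headSize≡2^⌊log₂⌋ 2≤n)) (2^⌊log₂n⌋≤n (<-≤-trans z<s 2≤n))

headSize[1+n]<n : ∀ {n} → 2 ≤ n → headSize (suc n) < n
headSize[1+n]<n {n} 2≤n = ≰⇒> λ n≤h → <-irrefl refl (begin-strict
  2 * n                  ≤⟨ *-monoʳ-≤ 2 n≤h ⟩
  2 * headSize (suc n)   ≤⟨ 2*headSize≤n (m≤n⇒m≤1+n 2≤n) ⟩
  suc n                  <⟨ +-monoˡ-< n 2≤n ⟩
  n + n                  ≡⟨ cong (n +_) (+-identityʳ n) ⟨
  2 * n                  ∎)
  where open ≤-Reasoning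

headSize-jump : ∀ {n} → 2 ≤ n → ⌊log₂ (suc n) ⌋ ≢ ⌊log₂ n ⌋ →
                headSize n + headSize (n ∸ headSize n) ≡ headSize (suc n)
headSize-jump {n} 2≤n jump = begin-equality
  h + headSize (n ∸ h)   ≡⟨ cong (λ k → h + 2 ^ (k ∸ 1)) ⌊log₂[n∸h]⌋≡k ⟩
  h + h                  ≡⟨ cong (h +_) (+-identityʳ h) ⟨
  2 * h                  ≡⟨ 2h≡2^k ⟩
  2 ^ k                  ≡⟨ cong (λ m → 2 ^ (m ∸ 1)) (⌊log₂[2^n]⌋≡n (suc k)) ⟨
  headSize (2 ^ suc k)   ≡⟨ cong headSize full ⟨
  headSize (suc n)       ∎
  where
  open ≤-Reasoning
  h : ℕ
  h = headSize n
  k : ℕ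
  k = ⌊log₂ n ⌋
  2h≡2^k : 2 * h ≡ 2 ^ k
  2h≡2^k = 2*headSize≡2^⌊log₂⌋ 2≤n
  full : suc n ≡ 2 ^ suc k
  full = ⌊log₂⌋-jump n jump
  3h<1+n : 2 * h + h < suc n
  3h<1+n = begin-strict
    2 * h + h       <⟨ m<m+n (2 * h + h) (m^n>0 2 (k ∸ 1)) ⟩
    2 * h + h + h   ≡⟨ 4*m≡2*m+m+m h ⟨
    2 * (2 * h)     ≡⟨ cong (2 *_) 2h≡2^k ⟩
    2 ^ suc k       ≡⟨ full ⟨
    suc n           ∎
    where
    4*m≡2*m+m+m : ∀ m → 2 * (2 * m) ≡ 2 * m + m + m
    4*m≡2*m+m+m = solve-∀
  ⌊log₂[n∸h]⌋≡k : ⌊log₂ (n ∸ h) ⌋ ≡ k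
  ⌊log₂[n∸h]⌋≡k = ⌊log₂⌋-unique k
    (subst (_≤ n ∸ h) 2h≡2^k (m+n≤o⇒m≤o∸n (2 * h) (s≤s⁻¹ 3h<1+n)))
    (subst (n ∸ h <_) full (s≤s (m∸n≤m n h)))

a<split : ∀ a b → a < split a b
a<split a b = m<m+n a (m^n>0 2 (⌊log₂ (suc b ∸ a) ⌋ ∸ 1))

split-offset : ∀ a k → split a (k + a) ≡ a + headSize (suc k)
split-offset a k = cong (λ n → a + headSize n) (m+n∸n≡m (suc k) a)

2≤[1+b]∸a : ∀ {a b} → a < b → 2 ≤ suc b ∸ a
2≤[1+b]∸a {a} {b} a<b = subst (_≤ suc b ∸ a) (m+n∸n≡m 2 a) (∸-monoˡ-≤ a (s≤s a<b))

split[1+b]≤b : ∀ {a b} → a < b → split a (suc b) ≤ b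
split[1+b]≤b {a} {b} a<b = begin
  a + headSize (suc (suc b) ∸ a)   ≡⟨ cong (λ n → a + headSize n) (+-∸-assoc 1 (m≤n⇒m≤1+n a≤b)) ⟩
  a + headSize (suc (suc b ∸ a))   ≤⟨ +-monoʳ-≤ a (s≤s⁻¹ h<1+[b∸a]) ⟩
  a + (b ∸ a)                      ≡⟨ m+[n∸m]≡n a≤b ⟩
  b                                ∎
  where
  open ≤-Reasoning
  a≤b : a ≤ b
  a≤b = <⇒≤ a<b
  h<1+[b∸a] : headSize (suc (suc b ∸ a)) < suc (b ∸ a)
  h<1+[b∸a] = subst (headSize (suc (suc b ∸ a)) <_) (+-∸-assoc 1 a≤b) (headSize[1+n]<n (2≤[1+b]∸a a<b))

split-≤ : ∀ {a b} → a < b → split a b ≤ b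
split-≤ {a} {b} a<b =
  ≤-trans (+-monoʳ-≤ a (headSize-mono-≤ (∸-monoˡ-≤ a (n≤1+n (suc b))))) (split[1+b]≤b a<b)

split-jump : ∀ {a b} → a < b → ⌊log₂ (suc (suc b) ∸ a) ⌋ ≢ ⌊log₂ (suc b ∸ a) ⌋ →
             split (split a b) b ≡ split a (suc b)
split-jump {a} {b} a<b jump = begin
  a + h + headSize (suc b ∸ (a + h))   ≡⟨ cong (λ m → a + h + headSize m) (∸-+-assoc (suc b) a h) ⟨
  a + h + headSize (n ∸ h)             ≡⟨ +-assoc a h _ ⟩
  a + (h + headSize (n ∸ h))           ≡⟨ cong (a +_) (headSize-jump (2≤[1+b]∸a a<b) jump′) ⟩
  a + headSize (suc n)                 ≡⟨ cong (λ m → a + headSize m) [2+b]∸a≡1+n ⟨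
  split a (suc b)                      ∎
  where
  open ≡-Reasoning
  n : ℕ
  n = suc b ∸ a
  h : ℕ
  h = headSize n
  [2+b]∸a≡1+n : suc (suc b) ∸ a ≡ suc n
  [2+b]∸a≡1+n = +-∸-assoc 1 (m≤n⇒m≤1+n (<⇒≤ a<b))
  jump′ : ⌊log₂ (suc n) ⌋ ≢ ⌊log₂ n ⌋
  jump′ eq = jump (trans (cong ⌊log₂_⌋ [2+b]∸a≡1+n) eq)

≡ᵇ-reflects-≡ : ∀ m n → Reflects (m ≡ n) (m ≡ᵇ n)
≡ᵇ-reflects-≡ m n = fromEquivalence (≡ᵇ⇒≡ m n) (≡⇒≡ᵇ m n)

fuel-step : ∀ {a b c f} → a < c → c ≤ b → b ∸ a < suc f → b ∸ c < f
fuel-step a<c c≤b fuel = <-≤-trans (∸-monoʳ-< a<c c≤b) (s≤s⁻¹ fuel)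

zetaF-fuel : ∀ f g {a b} → b ∸ a < f → b ∸ a < g → zetaF f a b ≡ zetaF g a b
zetaF-fuel (suc f) (suc g) {a} {b} fuel-f fuel-g with a <ᵇ b | <ᵇ-reflects-< a b
... | false | _       = refl
... | true  | ofʸ a<b = cong (B a (split a b) ∷_) (zetaF-fuel f g (fuel′ fuel-f) (fuel′ fuel-g))
  where
  fuel′ : ∀ {f} → b ∸ a < suc f → b ∸ split a b < f
  fuel′ = fuel-step (a<split a b) (split-≤ a<b)

ζ-< : ∀ {a b} → a < b → ζ a b ≡ B a (split a b) ∷ ζ (split a b) b
ζ-< {a} {b} a<b with a <ᵇ b | <ᵇ-reflects-< a b
... | false | ofⁿ a≮b = contradiction a<b a≮b
... | true  | _       = cong (B a (split a b) ∷_)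
  (zetaF-fuel (b ∸ a) _ (fuel-step (a<split a b) (split-≤ a<b) ≤-refl) ≤-refl)

ζ-self : ∀ b → ζ b b ≡ B b (suc b) ∷ []
ζ-self b with b <ᵇ b | <ᵇ-reflects-< b b
... | false | _       = refl
... | true  | ofʸ b<b = contradiction b<b (<-irrefl refl)

firstEnd-ζ : ∀ {a b} → a ≤ b → firstEnd (ζ a b) ≡ split a b
firstEnd-ζ {a} {b} a≤b with m≤n⇒m<n∨m≡n a≤b
... | inj₁ a<b  = cong firstEnd (ζ-< a<b)
... | inj₂ refl = trans (cong firstEnd (ζ-self a)) (sym (trans (split-offset a 0) (+-comm a 1)))

secondEnd-∷ : ∀ x xs → secondEnd (x ∷ xs) ≡ firstEnd xs
secondEnd-∷ x []       = refl
secondEnd-∷ x (y ∷ ys) = refl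

secondEnd-ζ : ∀ {a b} → a < b → secondEnd (ζ a b) ≡ split (split a b) b
secondEnd-ζ {a} {b} a<b = begin
  secondEnd (ζ a b)                              ≡⟨ cong secondEnd (ζ-< a<b) ⟩
  secondEnd (B a (split a b) ∷ ζ (split a b) b)  ≡⟨ secondEnd-∷ (B a (split a b)) (ζ (split a b) b) ⟩
  firstEnd (ζ (split a b) b)                     ≡⟨ firstEnd-ζ (split-≤ a<b) ⟩
  split (split a b) b                            ∎
  where open ≡-Reasoning

incrF-self : ∀ f b → incrF (suc f) b b ≡ B b (suc b) ∷ B (suc b) (suc (suc b)) ∷ []
incrF-self f b with b <ᵇ b | <ᵇ-reflects-< b b
... | false | _       = refl
... | true  | ofʸ b<b = contradiction b<b (<-irrefl refl)

incrF-< : ∀ f {a b} → a < b → incrF (suc f) a b ≡ B a (split a (suc b)) ∷ incrF f (split a (suc b)) b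
incrF-< f {a} {b} a<b with a <ᵇ b | <ᵇ-reflects-< a b
... | false | ofⁿ a≮b = contradiction a<b a≮b
... | true  | _
  with ⌊log₂ (suc (suc b) ∸ a) ⌋ ≡ᵇ ⌊log₂ (suc b ∸ a) ⌋
     | ≡ᵇ-reflects-≡ ⌊log₂ (suc (suc b) ∸ a) ⌋ ⌊log₂ (suc b ∸ a) ⌋
...   | true  | ofʸ same   = cong (λ v → B a v ∷ incrF f v b)
  (trans (firstEnd-ζ (<⇒≤ a<b)) (cong (λ k → a + 2 ^ (k ∸ 1)) (sym same)))
...   | false | ofⁿ jump   = cong (λ v → B a v ∷ incrF f v b)
  (trans (secondEnd-ζ a<b) (split-jump a<b jump))

incrF≡ζ[1+b] : ∀ f {a b} → b ∸ a < f → a ≤ b → incrF f a b ≡ ζ a (suc b)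
incrF≡ζ[1+b] (suc f) {a} {b} fuel a≤b with m≤n⇒m<n∨m≡n a≤b
... | inj₂ refl = begin
  incrF (suc f) a a                                      ≡⟨ incrF-self f a ⟩
  B a (suc a) ∷ B (suc a) (suc (suc a)) ∷ []             ≡⟨ cong (B a (suc a) ∷_) (ζ-self (suc a)) ⟨
  B a (suc a) ∷ ζ (suc a) (suc a)                        ≡⟨ cong (λ c → B a c ∷ ζ c (suc a)) split-a[1+a]≡1+a ⟨
  B a (split a (suc a)) ∷ ζ (split a (suc a)) (suc a)    ≡⟨ ζ-< (n<1+n a) ⟨
  ζ a (suc a)                                            ∎
  where
  open ≡-Reasoning
  split-a[1+a]≡1+a : split a (suc a) ≡ suc a
  split-a[1+a]≡1+a = trans (split-offset a 1) (+-comm a 1)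
... | inj₁ a<b = begin
  incrF (suc f) a b     ≡⟨ incrF-< f a<b ⟩
  B a c ∷ incrF f c b   ≡⟨ cong (B a c ∷_) (incrF≡ζ[1+b] f (fuel-step (a<split a (suc b)) c≤b fuel) c≤b) ⟩
  B a c ∷ ζ c (suc b)   ≡⟨ ζ-< (m<n⇒m<1+n a<b) ⟨
  ζ a (suc b)           ∎
  where
  open ≡-Reasoning
  c : ℕ
  c = split a (suc b)
  c≤b : c ≤ b
  c≤b = split[1+b]≤b a<b

lemma4p1 : (a b : ℕ) → a ≤ b → Incrζ a b ≡ ζ a (suc b)
lemma4p1 a b = incrF≡ζ[1+b] (suc (b ∸ a)) ≤-refl
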